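{- Let $a$ be a weak composition with at least one leading zero (that is, $a_1=0$) such that $\mathrm{flat}(a)=(\alpha_1,\alpha_2)$ with $\alpha_2>\alpha_1\ge 3$. Then $\kappa_a$ is not multiplicity free.
   Context: A weak composition $a=(a_1,\dots,a_\ell)$ of length $\ell$ is a finite sequence of nonnegative integers; $\mathrm{flat}(a)$ is the sequence obtained by deleting its zeros. A diagram is a finite set of cells $(r,c)$ with $r,c$ positive integers (row $r$ from the bottom, column $c$ from the left). A Kohnert tableau of content $a$ is a diagram filled with positive integers, exactly $a_i$ cells containing $i$ for each $i$, such that: (i) for each $i$ there is exactly one $i$ in each of the columns $1,\dots,a_i$; (ii) every entry in row $r$ is at least $r$; (iii) for each $i$, the cells containing $i$ weakly descend from left to right; (iv) if $i<j$ appear in the same column with $i$ above $j$, then there is an $i$ in the column immediately to the right of the cell containing that $j$, in a row strictly above it. It is quasi-Yamanouchi if moreover (v) for each nonempty row $r$, either row $r$ contains an entry equal to $r$, or some cell of row $r+1$ lies weakly to the right of some cell of row $r$. Let $\mathrm{QKT}(a)$ be the set of quasi-Yamanouchi Kohnert tableaux of content $a$, and $\mathrm{wt}(T)$ the weak composition of length $\ell$ whose $r$-th part is the number of cells in row $r$ of $T$. The key polynomial $\kappa_a$ satisfies $\kappa_a=\sum_{T\in\mathrm{QKT}(a)}\mathfrak{F}_{\mathrm{wt}(T)}$, where $\mathfrak{F}_b$ is the fundamental slide polynomial. We say $\kappa_a$ is multiplicity free if distinct tableaux in $\mathrm{QKT}(a)$ have distinct weights. -}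

module Defs where

open import Data.Nat using (ℕ; zero; suc; _+_; _≤_; _<_; _≟_)
open import Data.Fin using (Fin; toℕ)
open import Data.Vec using (Vec; []; _∷_; lookup; tabulate; toList)
open import Data.List using (List; []; _∷_)
open import Data.Bool using (if_then_else_)
open import Data.Product using (Σ; ∃; _×_; _,_)
open import Data.Sum using (_⊎_)
open import Relation.Nullary using (¬_)
open import Relation.Nullary.Decidable using (⌊_⌋)
open import Relation.Binary.PropositionalEquality using (_≡_; _≢_)

flat : List ℕ → List ℕ
flat [] = []
flat (zero ∷ xs) = flat xs
flat (suc n ∷ xs) = suc n ∷ flat xs

-- A filling of content a (a weak composition of length ℓ, entries i = 1..ℓ
-- represented by i : Fin ℓ with value suc (toℕ i)).  Condition (i) of the
-- definition is built in: for each entry i and each column c = 1..a_i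
-- (represented by c : Fin (a_i) with column number suc (toℕ c)) there is
-- exactly one cell containing i in column c, and  row i c  is its row.
-- The tableau is the set of cells (row i c , suc (toℕ c)) filled with i.
record Filling {ℓ : ℕ} (a : Vec ℕ ℓ) : Set where
  constructor mkFilling
  field
    row : (i : Fin ℓ) → Fin (lookup a i) → ℕ
open Filling public

val : {ℓ : ℕ} → Fin ℓ → ℕ
val i = suc (toℕ i)

col : {n : ℕ} → Fin n → ℕ
col c = suc (toℕ c)

-- Kohnert tableau of content a (conditions (i)-(iv)), plus the
-- requirement that the cells form a diagram (distinct cells, positive rows).
record IsKohnertTableau {ℓ : ℕ} (a : Vec ℕ ℓ) (T : Filling a) : Set where
  field
    rowPos : ∀ i c → 1 ≤ row T i c
    cellsDistinct : ∀ i j (c : Fin (lookup a i)) (d : Fin (lookup a j)) →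
      col c ≡ col d → row T i c ≡ row T j d → i ≡ j
    entryBound : ∀ i c → row T i c ≤ val i
    descend : ∀ i (c d : Fin (lookup a i)) → col c < col d → row T i d ≤ row T i c
    kohnert : ∀ i j (c : Fin (lookup a i)) (d : Fin (lookup a j)) →
      val i < val j → col c ≡ col d → row T j d < row T i c →
      Σ (Fin (lookup a i)) λ e → (col e ≡ suc (col d)) × (row T j d < row T i e)
open IsKohnertTableau public

NonemptyRow : {ℓ : ℕ} (a : Vec ℕ ℓ) → Filling a → ℕ → Set
NonemptyRow {ℓ} a T r = Σ (Fin ℓ) λ i → Σ (Fin (lookup a i)) λ c → row T i c ≡ r

IsQuasiYamanouchi : {ℓ : ℕ} (a : Vec ℕ ℓ) → Filling a → Set
IsQuasiYamanouchi {ℓ} a T = ∀ r → NonemptyRow a T r →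
    (Σ (Fin ℓ) λ i → Σ (Fin (lookup a i)) λ c → (row T i c ≡ r) × (val i ≡ r))
  ⊎ (Σ (Fin ℓ) λ i → Σ (Fin (lookup a i)) λ c →
     Σ (Fin ℓ) λ j → Σ (Fin (lookup a j)) λ d →
       (row T i c ≡ r) × (row T j d ≡ suc r) × (col c ≤ col d))

IsQKT : {ℓ : ℕ} (a : Vec ℕ ℓ) → Filling a → Set
IsQKT a T = IsKohnertTableau a T × IsQuasiYamanouchi a T

sumFin : (n : ℕ) → (Fin n → ℕ) → ℕ
sumFin zero f = 0
sumFin (suc n) f = f Fin.zero + sumFin n (λ k → f (Fin.suc k))

rowCount : {ℓ : ℕ} (a : Vec ℕ ℓ) → Filling a → ℕ → ℕ
rowCount {ℓ} a T r =
  sumFin ℓ λ i → sumFin (lookup a i) λ c → if ⌊ row T i c ≟ r ⌋ then 1 else 0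

wt : {ℓ : ℕ} (a : Vec ℕ ℓ) → Filling a → Vec ℕ ℓ
wt a T = tabulate λ r → rowCount a T (suc (toℕ r))

SameTableau : {ℓ : ℕ} (a : Vec ℕ ℓ) → Filling a → Filling a → Set
SameTableau a T U = ∀ i c → row T i c ≡ row U i c

MultiplicityFree : {ℓ : ℕ} → Vec ℕ ℓ → Set
MultiplicityFree a = ∀ (T U : Filling a) → IsQKT a T → IsQKT a U →
  wt a T ≡ wt a U → SameTableau a T U

module Submission where

open import Defs
open import Data.Nat using (ℕ; suc; _<_; _≤_)
open import Data.Vec using (Vec; head; toList)
open import Data.List using (_∷_; [])
open import Relation.Nullary using (¬_)
open import Relation.Binary.PropositionalEquality using (_≡_)

open import Data.Bool using (if_then_else_)
open import Data.Empty using (⊥-elim)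
open import Data.Fin using (Fin; toℕ; fromℕ<) renaming (zero to fzero; suc to fsuc)
import Data.Fin.Properties as Finₚ
open import Data.List.Properties using (∷-injectiveˡ; ∷-injectiveʳ)
open import Data.Nat using (zero; _+_; _*_; _≥_; z≤n; s≤s; _≟_; _<?_)
open import Data.Nat.Properties
open import Data.Nat.Solver using (module +-*-Solver)
open import Data.Product using (Σ; _×_; _,_)
open import Data.Sum using (_⊎_; inj₁; inj₂; map₂)
open import Data.Vec using (_∷_; lookup)
open import Data.Vec.Properties using (tabulate-cong)
open import Function using (const; _∘_)
open import Relation.Binary.Core using (_Preserves_⟶_)
open import Relation.Binary.PropositionalEquality
  using (_≢_; refl; sym; trans; cong; cong₂; subst; subst₂; module ≡-Reasoning)
open import Relation.Nullary using (yes; no)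
open import Relation.Nullary.Decidable using (⌊_⌋)

-- Let the nonzero parts α₁ < α₂ sit at entries p < q, so p ≥ 2 because a₁ = 0.
-- Two different quasi-Yamanouchi Kohnert tableaux have the same weight:
--   T : the p's lie in row p in columns 1..α₁-1 and in row p-1 in column α₁;
--       the q's lie in row q in columns 1..α₂-2, then in rows p and p-1;
--   U : the p's lie in row p in columns 1..α₁-2 and in row p-1 in the last two;
--       the q's lie in row q in columns 1..α₂-2 and in row p in the last two.
-- Both have α₁ cells in row p, two in row p-1 and α₂-2 in row q; the hypotheses ensure
-- that row p-1 exists, that U keeps a p in row p, and that the q's stay above the p's.

replicate++ : ℕ → ℕ → (ℕ → ℕ) → ℕ → ℕ
replicate++ zero    x f k       = f k
replicate++ (suc n) x f zero    = x
replicate++ (suc n) x f (suc k) = replicate++ n x f k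

replicate++-< : ∀ n x f {k} → k < n → replicate++ n x f k ≡ x
replicate++-< (suc n) x f {zero}  _         = refl
replicate++-< (suc n) x f {suc k} (s≤s k<n) = replicate++-< n x f k<n

replicate++-≥ : ∀ n x y {k} → n ≤ k → replicate++ n x (const y) k ≡ y
replicate++-≥ zero    x y _                 = refl
replicate++-≥ (suc n) x y {suc k} (s≤s n≤k) = replicate++-≥ n x y n≤k

replicate++-at : ∀ n x f → replicate++ n x f n ≡ f 0
replicate++-at zero    x f = refl
replicate++-at (suc n) x f = replicate++-at n x f

replicate++-cases : ∀ n x f k → replicate++ n x f k ≡ x ⊎ Σ ℕ (λ j → replicate++ n x f k ≡ f j)
replicate++-cases zero    x f k       = inj₂ (k , refl)
replicate++-cases (suc n) x f zero    = inj₁ refl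
replicate++-cases (suc n) x f (suc k) = replicate++-cases n x f k

replicate++-const-cases : ∀ n x y k →
  replicate++ n x (const y) k ≡ x ⊎ replicate++ n x (const y) k ≡ y
replicate++-const-cases n x y k with replicate++-cases n x (const y) k
... | inj₁ ≡x       = inj₁ ≡x
... | inj₂ (_ , ≡y) = inj₂ ≡y

replicate++-≤ : ∀ {c} n {x f} → x ≤ c → (∀ k → f k ≤ c) → ∀ k → replicate++ n x f k ≤ c
replicate++-≤ zero    x≤c f≤c k       = f≤c k
replicate++-≤ (suc n) x≤c f≤c zero    = x≤c
replicate++-≤ (suc n) x≤c f≤c (suc k) = replicate++-≤ n x≤c f≤c k

≤-replicate++ : ∀ {c} n {x f} → c ≤ x → (∀ k → c ≤ f k) → ∀ k → c ≤ replicate++ n x f k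
≤-replicate++ zero    c≤x c≤f k       = c≤f k
≤-replicate++ (suc n) c≤x c≤f zero    = c≤x
≤-replicate++ (suc n) c≤x c≤f (suc k) = ≤-replicate++ n c≤x c≤f k

≤-replicate++-< : ∀ {c} n m {x f} → c ≤ x → (∀ j → j < m → c ≤ f j) →
  ∀ k → k < n + m → c ≤ replicate++ n x f k
≤-replicate++-< zero    m c≤x c≤f k       k<m         = c≤f k k<m
≤-replicate++-< (suc n) m c≤x c≤f zero    _           = c≤x
≤-replicate++-< (suc n) m c≤x c≤f (suc k) (s≤s k<n+m) = ≤-replicate++-< n m c≤x c≤f k k<n+m

replicate++-antitone : ∀ n {x f} → (∀ k → f k ≤ x) → f Preserves _≤_ ⟶ _≥_ →
  replicate++ n x f Preserves _≤_ ⟶ _≥_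
replicate++-antitone zero    f≤x f↓ k≤l = f↓ k≤l
replicate++-antitone (suc n) f≤x f↓ {zero}  {zero}  _         = ≤-refl
replicate++-antitone (suc n) f≤x f↓ {zero}  {suc l} _         = replicate++-≤ n ≤-refl f≤x l
replicate++-antitone (suc n) f≤x f↓ {suc k} {suc l} (s≤s k≤l) = replicate++-antitone n f≤x f↓ k≤l

sumFin-cong : ∀ n {F G : Fin n → ℕ} → (∀ c → F c ≡ G c) → sumFin n F ≡ sumFin n G
sumFin-cong zero    F≡G = refl
sumFin-cong (suc n) F≡G = cong₂ _+_ (F≡G fzero) (sumFin-cong n (F≡G ∘ fsuc))

sumFin-zero : ∀ n (F : Fin n → ℕ) → (∀ i → F i ≡ 0) → sumFin n F ≡ 0
sumFin-zero zero    F F≡0 = refl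
sumFin-zero (suc n) F F≡0 rewrite F≡0 fzero = sumFin-zero n (F ∘ fsuc) (F≡0 ∘ fsuc)

fsuc-preserves-≢ : ∀ {n} {i j : Fin n} → i ≢ j → fsuc i ≢ fsuc j
fsuc-preserves-≢ i≢j = i≢j ∘ Finₚ.suc-injective

fsuc-reflects-≢ : ∀ {n} {i j : Fin n} → fsuc i ≢ fsuc j → i ≢ j
fsuc-reflects-≢ si≢sj = si≢sj ∘ cong fsuc

sumFin-single : ∀ n (F : Fin n → ℕ) P → (∀ i → i ≢ P → F i ≡ 0) → sumFin n F ≡ F P
sumFin-single (suc n) F fzero F≡0
  rewrite sumFin-zero n (F ∘ fsuc) (λ i → F≡0 (fsuc i) λ ()) = +-identityʳ (F fzero)
sumFin-single (suc n) F (fsuc P) F≡0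
  rewrite F≡0 fzero (λ ()) = sumFin-single n (F ∘ fsuc) P (λ i → F≡0 (fsuc i) ∘ fsuc-preserves-≢)

sumFin-pair : ∀ n (F : Fin n → ℕ) P Q → P ≢ Q → (∀ i → i ≢ P → i ≢ Q → F i ≡ 0) →
  sumFin n F ≡ F P + F Q
sumFin-pair (suc n) F fzero    fzero    P≢Q F≡0 = ⊥-elim (P≢Q refl)
sumFin-pair (suc n) F fzero    (fsuc Q) P≢Q F≡0 =
  cong (F fzero +_) (sumFin-single n (F ∘ fsuc) Q (λ i → F≡0 (fsuc i) (λ ()) ∘ fsuc-preserves-≢))
sumFin-pair (suc n) F (fsuc P) fzero    P≢Q F≡0 =
  trans (cong (F fzero +_)
           (sumFin-single n (F ∘ fsuc) P (λ i i≢P → F≡0 (fsuc i) (fsuc-preserves-≢ i≢P) (λ ()))))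
        (+-comm (F fzero) (F (fsuc P)))
sumFin-pair (suc n) F (fsuc P) (fsuc Q) P≢Q F≡0 rewrite F≡0 fzero (λ ()) (λ ()) =
  sumFin-pair n (F ∘ fsuc) P Q (P≢Q ∘ cong fsuc)
    (λ i i≢P i≢Q → F≡0 (fsuc i) (fsuc-preserves-≢ i≢P) (fsuc-preserves-≢ i≢Q))

sumFin-replicate++ : ∀ {l} N K x f (h : ℕ → ℕ) → l ≡ N + K →
  sumFin l (h ∘ replicate++ N x f ∘ toℕ) ≡ N * h x + sumFin K (h ∘ f ∘ toℕ)
sumFin-replicate++ zero    K x f h refl = refl
sumFin-replicate++ (suc N) K x f h refl =
  trans (cong (h x +_) (sumFin-replicate++ N K x f h refl)) (sym (+-assoc (h x) (N * h x) _))

flat-empty : ∀ {n} (v : Vec ℕ n) → flat (toList v) ≡ [] → ∀ i → lookup v i ≡ 0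
flat-empty (zero ∷ v) flat≡ fzero    = refl
flat-empty (zero ∷ v) flat≡ (fsuc i) = flat-empty v flat≡ i

flat-single : ∀ {n} (v : Vec ℕ n) x → flat (toList v) ≡ x ∷ [] →
  Σ (Fin n) λ P → lookup v P ≡ x × (∀ i → i ≢ P → lookup v i ≡ 0)
flat-single (zero ∷ v) x flat≡ with flat-single v x flat≡
... | P , vP≡x , rest =
  fsuc P , vP≡x , λ { fzero _ → refl ; (fsuc i) i≢P → rest i (fsuc-reflects-≢ i≢P) }
flat-single (suc y ∷ v) x flat≡ =
  fzero , ∷-injectiveˡ flat≡ ,
  λ { fzero i≢P → ⊥-elim (i≢P refl) ; (fsuc i) _ → flat-empty v (∷-injectiveʳ flat≡) i }

flat-pair : ∀ {n} (v : Vec ℕ n) x y → flat (toList v) ≡ x ∷ y ∷ [] →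
  Σ (Fin n) λ P → Σ (Fin n) λ Q → toℕ P < toℕ Q × lookup v P ≡ x × lookup v Q ≡ y ×
    (∀ i → i ≢ P → i ≢ Q → lookup v i ≡ 0)
flat-pair (zero ∷ v) x y flat≡ with flat-pair v x y flat≡
... | P , Q , P<Q , vP≡x , vQ≡y , rest =
  fsuc P , fsuc Q , s≤s P<Q , vP≡x , vQ≡y ,
  λ { fzero _ _ → refl ; (fsuc i) i≢P i≢Q → rest i (fsuc-reflects-≢ i≢P) (fsuc-reflects-≢ i≢Q) }
flat-pair (suc z ∷ v) x y flat≡ with flat-single v y (∷-injectiveʳ flat≡)
... | Q , vQ≡y , rest =
  fzero , fsuc Q , s≤s z≤n , ∷-injectiveˡ flat≡ , vQ≡y ,
  λ { fzero i≢P _ → ⊥-elim (i≢P refl) ; (fsuc i) _ i≢Q → rest i (fsuc-reflects-≢ i≢Q) }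

head≡0⇒0<toℕ : ∀ {ℓ} (v : Vec ℕ (suc ℓ)) {i k} → head v ≡ 0 → lookup v i ≡ suc k → 0 < toℕ i
head≡0⇒0<toℕ (x ∷ v) {fzero}  x≡0 x≡suc with trans (sym x≡0) x≡suc
... | ()
head≡0⇒0<toℕ (x ∷ v) {fsuc i} _   _     = s≤s z≤n

module TwoEntries {L : ℕ} (a : Vec ℕ L) (P Q : Fin L) (P<Q : toℕ P < toℕ Q)
  (support : ∀ i → i ≢ P → i ≢ Q → lookup a i ≡ 0) where

  P≢Q : P ≢ Q
  P≢Q P≡Q = <⇒≢ P<Q (cong toℕ P≡Q)

  -- f and g give the rows of the entries P and Q as functions of the 0-based column index.
  rows : (f g : ℕ → ℕ) (i : Fin L) → Fin (lookup a i) → ℕ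
  rows f g i c with i Finₚ.≟ P
  ... | yes _ = f (toℕ c)
  ... | no _ with i Finₚ.≟ Q
  ...   | yes _ = g (toℕ c)
  ...   | no _  = 0

  filling : (f g : ℕ → ℕ) → Filling a
  filling f g = mkFilling (rows f g)

  rows-P : ∀ f g c → rows f g P c ≡ f (toℕ c)
  rows-P f g c with P Finₚ.≟ P
  ... | yes _   = refl
  ... | no P≢P = ⊥-elim (P≢P refl)

  rows-Q : ∀ f g c → rows f g Q c ≡ g (toℕ c)
  rows-Q f g c with Q Finₚ.≟ P
  ... | yes Q≡P = ⊥-elim (P≢Q (sym Q≡P))
  ... | no _ with Q Finₚ.≟ Q
  ...   | yes _   = refl
  ...   | no Q≢Q = ⊥-elim (Q≢Q refl)

  occupied : ∀ i → Fin (lookup a i) → i ≡ P ⊎ i ≡ Q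
  occupied i c with i Finₚ.≟ P | i Finₚ.≟ Q
  ... | yes i≡P | _       = inj₁ i≡P
  ... | no _    | yes i≡Q = inj₂ i≡Q
  ... | no i≢P  | no i≢Q  with subst Fin (support i i≢P i≢Q) c
  ...   | ()

  record KohnertShape (f g : ℕ → ℕ) : Set where
    field
      f-positive : ∀ k → 1 ≤ f k
      g-positive : ∀ k → 1 ≤ g k
      f≤val      : ∀ k → f k ≤ val P
      g≤val      : ∀ k → g k ≤ val Q
      f-antitone : f Preserves _≤_ ⟶ _≥_
      g-antitone : g Preserves _≤_ ⟶ _≥_
      f<g        : ∀ k → k < lookup a P → f k < g k

  isKohnertTableau : ∀ {f g} → KohnertShape f g → IsKohnertTableau a (filling f g)
  isKohnertTableau {f} {g} shape = record
    { rowPos = positive ; cellsDistinct = distinct ; entryBound = bounded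
    ; descend = descending ; kohnert = kohnert-vacuous }
    where
    open KohnertShape shape

    positive : ∀ i c → 1 ≤ rows f g i c
    positive i c with occupied i c
    ... | inj₁ refl rewrite rows-P f g c = f-positive _
    ... | inj₂ refl rewrite rows-Q f g c = g-positive _

    distinct : ∀ i j (c : Fin (lookup a i)) (d : Fin (lookup a j)) →
      col c ≡ col d → rows f g i c ≡ rows f g j d → i ≡ j
    distinct i j c d c≡d same with occupied i c | occupied j d
    ... | inj₁ refl | inj₁ refl = refl
    ... | inj₂ refl | inj₂ refl = refl
    ... | inj₁ refl | inj₂ refl rewrite rows-P f g c | rows-Q f g d =
      ⊥-elim (<⇒≢ (f<g _ (Finₚ.toℕ<n c)) (trans same (cong g (sym (suc-injective c≡d)))))
    ... | inj₂ refl | inj₁ refl rewrite rows-P f g d | rows-Q f g c =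
      ⊥-elim (<⇒≢ (f<g _ (Finₚ.toℕ<n d)) (trans (sym same) (cong g (suc-injective c≡d))))

    bounded : ∀ i c → rows f g i c ≤ val i
    bounded i c with occupied i c
    ... | inj₁ refl rewrite rows-P f g c = f≤val _
    ... | inj₂ refl rewrite rows-Q f g c = g≤val _

    descending : ∀ i (c d : Fin (lookup a i)) → col c < col d → rows f g i d ≤ rows f g i c
    descending i c d (s≤s c<d) with occupied i c
    ... | inj₁ refl rewrite rows-P f g c | rows-P f g d = f-antitone (<⇒≤ c<d)
    ... | inj₂ refl rewrite rows-Q f g c | rows-Q f g d = g-antitone (<⇒≤ c<d)

    -- Q lies strictly above P in every column where both occur, so (iv) never applies.
    kohnert-vacuous : ∀ i j (c : Fin (lookup a i)) (d : Fin (lookup a j)) →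
      val i < val j → col c ≡ col d → rows f g j d < rows f g i c →
      Σ (Fin (lookup a i)) λ e → col e ≡ suc (col d) × rows f g j d < rows f g i e
    kohnert-vacuous i j c d i<j c≡d below with occupied i c | occupied j d
    ... | inj₁ refl | inj₁ refl = ⊥-elim (n≮n _ i<j)
    ... | inj₂ refl | inj₂ refl = ⊥-elim (n≮n _ i<j)
    ... | inj₂ refl | inj₁ refl = ⊥-elim (<-asym (s≤s P<Q) i<j)
    ... | inj₁ refl | inj₂ refl rewrite rows-P f g c | rows-Q f g d =
      ⊥-elim (<-asym below
        (subst (λ k → f (toℕ c) < g k) (suc-injective c≡d) (f<g _ (Finₚ.toℕ<n c))))

  -- Row toℕ P, just below the row of P, satisfies (v) thanks to the Q in column kg.
  record QuasiYamanouchiShape (f g : ℕ → ℕ) : Set where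
    field
      f-rows : ∀ k → f k ≡ val P ⊎ f k ≡ toℕ P
      g-rows : ∀ k → g k ≡ val Q ⊎ g k ≡ val P ⊎ g k ≡ toℕ P
      f-top  : f 0 ≡ val P
      kf kg  : ℕ
      kf<α   : kf < lookup a P
      kg<α   : kg < lookup a Q
      f-kf   : f kf ≡ toℕ P
      g-kg   : g kg ≡ val P
      kf≤kg  : kf ≤ kg

  QuasiYamanouchiAt : Filling a → ℕ → Set
  QuasiYamanouchiAt T r =
      (Σ (Fin L) λ i → Σ (Fin (lookup a i)) λ c → row T i c ≡ r × val i ≡ r)
    ⊎ (Σ (Fin L) λ i → Σ (Fin (lookup a i)) λ c → Σ (Fin L) λ j → Σ (Fin (lookup a j)) λ d →
         row T i c ≡ r × row T j d ≡ suc r × col c ≤ col d)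

  isQuasiYamanouchi : ∀ {f g} → QuasiYamanouchiShape f g → IsQuasiYamanouchi a (filling f g)
  isQuasiYamanouchi {f} {g} shape r (i , c , in-r) = witness i c in-r
    where
    open QuasiYamanouchiShape shape

    cf : Fin (lookup a P)
    cf = fromℕ< kf<α

    cg : Fin (lookup a Q)
    cg = fromℕ< kg<α

    toℕ-cf : toℕ cf ≡ kf
    toℕ-cf = Finₚ.toℕ-fromℕ< kf<α

    toℕ-cg : toℕ cg ≡ kg
    toℕ-cg = Finₚ.toℕ-fromℕ< kg<α

    below-P : r ≡ toℕ P → QuasiYamanouchiAt (filling f g) r
    below-P r≡p = inj₂ (P , cf , Q , cg ,
      trans (rows-P f g cf) (trans (cong f toℕ-cf) (trans f-kf (sym r≡p))) ,
      trans (rows-Q f g cg) (trans (cong g toℕ-cg) (trans g-kg (cong suc (sym r≡p)))) ,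
      subst₂ (λ u v → suc u ≤ suc v) (sym toℕ-cf) (sym toℕ-cg) (s≤s kf≤kg))

    c₀ : Fin (lookup a P)
    c₀ = fromℕ< (≤-<-trans z≤n kf<α)

    witness : ∀ i (c : Fin (lookup a i)) → rows f g i c ≡ r → QuasiYamanouchiAt (filling f g) r
    witness i c in-r with occupied i c
    witness i c in-r | inj₁ refl with f-rows (toℕ c)
    ... | inj₁ at-P = inj₁ (P , c , in-r , trans (sym (trans (rows-P f g c) at-P)) in-r)
    ... | inj₂ at-p = below-P (trans (sym in-r) (trans (rows-P f g c) at-p))
    witness i c in-r | inj₂ refl with g-rows (toℕ c)
    ... | inj₁ at-Q = inj₁ (Q , c , in-r , trans (sym (trans (rows-Q f g c) at-Q)) in-r)
    ... | inj₂ (inj₂ at-p) = below-P (trans (sym in-r) (trans (rows-Q f g c) at-p))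
    ... | inj₂ (inj₁ at-P) = inj₁ (P , c₀ ,
      trans (rows-P f g c₀) (trans (cong f (Finₚ.toℕ-fromℕ< _)) (trans f-top r≡P)) , r≡P)
      where
      r≡P : val P ≡ r
      r≡P = trans (sym at-P) (trans (sym (rows-Q f g c)) in-r)

  indicator : ℕ → ℕ → ℕ
  indicator r v = if ⌊ v ≟ r ⌋ then 1 else 0

  rowCount-filling : ∀ f g r → rowCount a (filling f g) r ≡
    sumFin (lookup a P) (indicator r ∘ f ∘ toℕ) + sumFin (lookup a Q) (indicator r ∘ g ∘ toℕ)
  rowCount-filling f g r =
    trans (sumFin-pair L count P Q P≢Q (λ i i≢P i≢Q → empty (support i i≢P i≢Q)))
          (cong₂ _+_ (sumFin-cong _ (cong (indicator r) ∘ rows-P f g))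
                     (sumFin-cong _ (cong (indicator r) ∘ rows-Q f g)))
    where
    count : Fin L → ℕ
    count i = sumFin (lookup a i) (indicator r ∘ rows f g i)

    empty : ∀ {n} {F : Fin n → ℕ} → n ≡ 0 → sumFin n F ≡ 0
    empty refl = refl

module TwoTableaux {L : ℕ} (a : Vec ℕ L) (P Q : Fin L) (P<Q : toℕ P < toℕ Q)
  (support : ∀ i → i ≢ P → i ≢ Q → lookup a i ≡ 0)
  (n m : ℕ) (n≤m : n ≤ m) (αP : lookup a P ≡ 3 + n) (αQ : lookup a Q ≡ 4 + m)
  (0<p-1 : 0 < toℕ P) where

  open TwoEntries a P Q P<Q support

  p p-1 q : ℕ
  p   = val P
  p-1 = toℕ P
  q   = val Q

  fT gT fU gU : ℕ → ℕ
  fT = replicate++ (2 + n) p (const p-1)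
  gT = replicate++ (2 + m) q (replicate++ 1 p (const p-1))
  fU = replicate++ (1 + n) p (const p-1)
  gU = replicate++ (2 + m) q (const p)

  T U : Filling a
  T = filling fT gT
  U = filling fU gU

  p<q : p < q
  p<q = s≤s P<Q

  p≤q : p ≤ q
  p≤q = <⇒≤ p<q

  const-antitone : ∀ y → const y Preserves _≤_ ⟶ _≥_
  const-antitone y _ = ≤-refl

  kohnertT : KohnertShape fT gT
  kohnertT = record
    { f-positive = ≤-replicate++ (2 + n) (s≤s z≤n) (const 0<p-1)
    ; g-positive = ≤-replicate++ (2 + m) (s≤s z≤n) (≤-replicate++ 1 (s≤s z≤n) (const 0<p-1))
    ; f≤val      = replicate++-≤ (2 + n) ≤-refl (const (n≤1+n p-1))
    ; g≤val      = replicate++-≤ (2 + m) ≤-refl tail≤q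
    ; f-antitone = replicate++-antitone (2 + n) (const (n≤1+n p-1)) (const-antitone p-1)
    ; g-antitone = replicate++-antitone (2 + m) tail≤q
                     (replicate++-antitone 1 (const (n≤1+n p-1)) (const-antitone p-1))
    ; f<g        = λ k k<α → fT<gT k (subst (k <_) αP k<α)
    }
    where
    tail≤q : ∀ k → replicate++ 1 p (const p-1) k ≤ q
    tail≤q = replicate++-≤ 1 p≤q (const (≤-trans (n≤1+n p-1) p≤q))

    fT<gT : ∀ k → k < 3 + n → fT k < gT k
    fT<gT k k<α with k <? 2 + n
    ... | yes k<n rewrite replicate++-< (2 + n) p (const p-1) k<n
                        | replicate++-< (2 + m) q (replicate++ 1 p (const p-1))
                            (<-≤-trans k<n (s≤s (s≤s n≤m))) = p<q
    ... | no k≮n rewrite replicate++-≥ (2 + n) p p-1 (≮⇒≥ k≮n) =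
      ≤-replicate++-< (2 + m) 1 p≤q (λ { zero _ → ≤-refl ; (suc _) (s≤s ()) }) k
        (<-≤-trans k<α (subst (3 + n ≤_) (+-comm 1 (2 + m)) (s≤s (s≤s (s≤s n≤m)))))

  kohnertU : KohnertShape fU gU
  kohnertU = record
    { f-positive = ≤-replicate++ (1 + n) (s≤s z≤n) (const 0<p-1)
    ; g-positive = ≤-replicate++ (2 + m) (s≤s z≤n) (const (s≤s z≤n))
    ; f≤val      = replicate++-≤ (1 + n) ≤-refl (const (n≤1+n p-1))
    ; g≤val      = replicate++-≤ (2 + m) ≤-refl (const p≤q)
    ; f-antitone = replicate++-antitone (1 + n) (const (n≤1+n p-1)) (const-antitone p-1)
    ; g-antitone = replicate++-antitone (2 + m) (const p≤q) (const-antitone p)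
    ; f<g        = λ k k<α → fU<gU k (subst (k <_) αP k<α)
    }
    where
    fU<gU : ∀ k → k < 3 + n → fU k < gU k
    fU<gU k k<α with k <? 1 + n
    ... | yes k<n rewrite replicate++-< (1 + n) p (const p-1) k<n
                        | replicate++-< (2 + m) q (const p)
                            (<-≤-trans k<n (s≤s (m≤n⇒m≤1+n n≤m))) = p<q
    ... | no k≮n rewrite replicate++-≥ (1 + n) p p-1 (≮⇒≥ k≮n) =
      ≤-replicate++ (2 + m) p≤q (const ≤-refl) k

  quasiYamanouchiT : QuasiYamanouchiShape fT gT
  quasiYamanouchiT = record
    { f-rows = replicate++-const-cases (2 + n) p p-1
    ; g-rows = g-rows
    ; f-top  = refl
    ; kf = 2 + n ; kg = 2 + m
    ; kf<α   = subst (2 + n <_) (sym αP) ≤-refl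
    ; kg<α   = subst (2 + m <_) (sym αQ) (n≤1+n (3 + m))
    ; f-kf   = replicate++-≥ (2 + n) p p-1 ≤-refl
    ; g-kg   = replicate++-at (2 + m) q _
    ; kf≤kg  = s≤s (s≤s n≤m)
    }
    where
    g-rows : ∀ k → gT k ≡ q ⊎ gT k ≡ p ⊎ gT k ≡ p-1
    g-rows k with replicate++-cases (2 + m) q (replicate++ 1 p (const p-1)) k
    ... | inj₁ at-q             = inj₁ at-q
    ... | inj₂ (zero , at-p)    = inj₂ (inj₁ at-p)
    ... | inj₂ (suc _ , at-p-1) = inj₂ (inj₂ at-p-1)

  quasiYamanouchiU : QuasiYamanouchiShape fU gU
  quasiYamanouchiU = record
    { f-rows = replicate++-const-cases (1 + n) p p-1
    ; g-rows = λ k → map₂ inj₁ (replicate++-const-cases (2 + m) q p k)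
    ; f-top  = refl
    ; kf = 2 + n ; kg = 3 + m
    ; kf<α   = subst (2 + n <_) (sym αP) ≤-refl
    ; kg<α   = subst (3 + m <_) (sym αQ) ≤-refl
    ; f-kf   = replicate++-≥ (1 + n) p p-1 (n≤1+n (1 + n))
    ; g-kg   = replicate++-≥ (2 + m) q p (n≤1+n (2 + m))
    ; kf≤kg  = s≤s (s≤s (m≤n⇒m≤1+n n≤m))
    }

  rowCount-T≡U : ∀ r → rowCount a T r ≡ rowCount a U r
  rowCount-T≡U r = begin
    rowCount a T r
      ≡⟨ rowCount-filling fT gT r ⟩
    sumFin (lookup a P) (δ ∘ fT ∘ toℕ) + sumFin (lookup a Q) (δ ∘ gT ∘ toℕ)
      ≡⟨ cong₂ _+_ (sumFin-replicate++ (2 + n) 1 p (const p-1) δ αP-T)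
                   (sumFin-replicate++ (2 + m) 2 q _ δ αQ′) ⟩
    (2 + n) * x + (y + 0) + ((2 + m) * z + (x + (y + 0)))
      ≡⟨ solve 5 (λ n m x y z →
           (con 2 :+ n) :* x :+ (y :+ con 0) :+ ((con 2 :+ m) :* z :+ (x :+ (y :+ con 0)))
        := (con 1 :+ n) :* x :+ (y :+ (y :+ con 0)) :+ ((con 2 :+ m) :* z :+ (x :+ (x :+ con 0))))
         refl n m x y z ⟩
    (1 + n) * x + (y + (y + 0)) + ((2 + m) * z + (x + (x + 0)))
      ≡⟨ sym (cong₂ _+_ (sumFin-replicate++ (1 + n) 2 p (const p-1) δ αP-U)
                        (sumFin-replicate++ (2 + m) 2 q (const p) δ αQ′)) ⟩
    sumFin (lookup a P) (δ ∘ fU ∘ toℕ) + sumFin (lookup a Q) (δ ∘ gU ∘ toℕ)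
      ≡⟨ sym (rowCount-filling fU gU r) ⟩
    rowCount a U r ∎
    where
    open ≡-Reasoning
    open +-*-Solver
    δ : ℕ → ℕ
    δ = indicator r
    x y z : ℕ
    x = δ p
    y = δ p-1
    z = δ q
    αP-T : lookup a P ≡ (2 + n) + 1
    αP-T = trans αP (cong (2 +_) (+-comm 1 n))
    αP-U : lookup a P ≡ (1 + n) + 2
    αP-U = trans αP (cong suc (+-comm 2 n))
    αQ′ : lookup a Q ≡ (2 + m) + 2
    αQ′ = trans αQ (cong (2 +_) (+-comm 2 m))

  T≢U : ¬ SameTableau a T U
  T≢U same = 1+n≢n (begin
    p           ≡⟨ sym (replicate++-< (2 + n) p (const p-1) ≤-refl) ⟩
    fT (1 + n)  ≡⟨ cong fT (sym column) ⟩
    fT (toℕ c)  ≡⟨ sym (rows-P fT gT c) ⟩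
    row T P c   ≡⟨ same P c ⟩
    row U P c   ≡⟨ rows-P fU gU c ⟩
    fU (toℕ c)  ≡⟨ cong fU column ⟩
    fU (1 + n)  ≡⟨ replicate++-≥ (1 + n) p p-1 ≤-refl ⟩
    p-1         ∎)
    where
    open ≡-Reasoning
    c : Fin (lookup a P)
    c = fromℕ< (subst (1 + n <_) (sym αP) (n≤1+n (2 + n)))
    column : toℕ c ≡ 1 + n
    column = Finₚ.toℕ-fromℕ< _

  ¬multiplicityFree : ¬ MultiplicityFree a
  ¬multiplicityFree mf = T≢U (mf T U
    (isKohnertTableau kohnertT , isQuasiYamanouchi quasiYamanouchiT)
    (isKohnertTableau kohnertU , isQuasiYamanouchi quasiYamanouchiU)
    (tabulate-cong (λ r → rowCount-T≡U (suc (toℕ r)))))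

lemma5p5 : ∀ {ℓ : ℕ} (a : Vec ℕ (suc ℓ)) (α₁ α₂ : ℕ) →
    head a ≡ 0 → flat (toList a) ≡ α₁ ∷ α₂ ∷ [] → 3 ≤ α₁ → α₁ < α₂ →
    ¬ MultiplicityFree a
lemma5p5 a (suc (suc (suc n))) (suc (suc (suc (suc m)))) head≡0 flat≡
         (s≤s (s≤s (s≤s z≤n))) (s≤s (s≤s (s≤s (s≤s n≤m))))
  with flat-pair a _ _ flat≡
... | P , Q , P<Q , αP , αQ , support =
  TwoTableaux.¬multiplicityFree a P Q P<Q support n m n≤m αP αQ (head≡0⇒0<toℕ a head≡0 αP)
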